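{- Let $x,y\in\Pi_n^B$ with $x\prec y$. For every saturated chain $x=x_0\prec\!\!\cdot\, x_1\prec\!\!\cdot\cdots\prec\!\!\cdot\, x_k=y$, the set of labels $\{\lambda(x_i,x_{i+1}) : i=0,\dots,k-1\}$ is the same (independent of the chain).
   Context: $\Pi_n^B$ is the set of partitions $\pi$ of $\{ -n,\dots,n\}$ such that (1) $B\in\pi$ implies $-B\in\pi$, and (2) if $i,-i\in B$ for some $i$ and some block $B$, then $0\in B$. It is ordered by refinement: $x\preceq y$ iff every block of $x$ is contained in a block of $y$. The block containing $0$ is the zero block. It is graded by $r(\pi)=n-(|\pi|-1)/2$. For a cover relation $\pi\prec\!\!\cdot\,\pi'$ there are two distinct blocks $B_1,B_2\in\pi$, neither the zero block, contained in the same block of $\pi'$, and one sets $\lambda(\pi,\pi')=\max\{\min|B_1|,\min|B_2|\}$, where $|B|=\{|b|:b\in B\}$; this is well defined. -}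

module Defs where

open import Data.Nat using (ℕ; _≤_; z≤n; _⊔_)
open import Data.Integer using (ℤ; +_; -_; ∣_∣)
open import Data.Integer.Properties using (∣-i∣≡∣i∣)
open import Data.Bool using (Bool; T)
open import Data.Product using (Σ; ∃; _×_; _,_; proj₁)
open import Relation.Nullary using (¬_)
open import Relation.Binary.PropositionalEquality using (_≡_; subst; sym)
open import Function.Bundles using (_⇔_)

Elem : ℕ → Set
Elem n = Σ ℤ (λ i → ∣ i ∣ ≤ n)

0ₑ : ∀ {n} → Elem n
0ₑ = (+ 0 , z≤n)

negₑ : ∀ {n} → Elem n → Elem n
negₑ (i , p) = (- i , subst (_≤ _) (sym (∣-i∣≡∣i∣ i)) p)

absₑ : ∀ {n} → Elem n → ℕ
absₑ (i , _) = ∣ i ∣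

-- A type-B partition of {-n,…,n}, given by its (decidable) "same block" relation.
record ΠB (n : ℕ) : Set where
  field
    blk    : Elem n → Elem n → Bool
  _∼_ : Elem n → Elem n → Set
  a ∼ b = T (blk a b)
  field
    ∼-refl  : ∀ a → a ∼ a
    ∼-sym   : ∀ {a b} → a ∼ b → b ∼ a
    ∼-trans : ∀ {a b c} → a ∼ b → b ∼ c → a ∼ c
    ∼-neg   : ∀ {a b} → a ∼ b → negₑ a ∼ negₑ b
    ∼-zero  : ∀ {a} → a ∼ negₑ a → a ∼ 0ₑ

open ΠB public

_≼_ : ∀ {n} → ΠB n → ΠB n → Set
x ≼ y = ∀ a b → _∼_ x a b → _∼_ y a b

_≺_ : ∀ {n} → ΠB n → ΠB n → Set
x ≺ y = x ≼ y × ¬ (y ≼ x)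

_⋖_ : ∀ {n} → ΠB n → ΠB n → Set
_⋖_ {n} x y = x ≺ y × ¬ (Σ (ΠB n) λ z → x ≺ z × z ≺ y)

MinAbs : ∀ {n} → ΠB n → Elem n → ℕ → Set
MinAbs x a m = (∃ λ c → _∼_ x c a × absₑ c ≡ m) × (∀ c → _∼_ x c a → m ≤ absₑ c)

Label : ∀ {n} → ΠB n → ΠB n → ℕ → Set
Label x y l = ∃ λ a → ∃ λ b → ∃ λ m₁ → ∃ λ m₂ →
  ¬ (_∼_ x a 0ₑ) × ¬ (_∼_ x b 0ₑ) × ¬ (_∼_ x a b) × _∼_ y a b ×
  MinAbs x a m₁ × MinAbs x b m₂ × l ≡ m₁ ⊔ m₂

data Chain {n : ℕ} : ΠB n → ΠB n → Set where
  done : ∀ {x} → Chain x x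
  step : ∀ {x z y} → x ⋖ z → Chain z y → Chain x y

data _∈Labels_ {n : ℕ} (l : ℕ) : ∀ {x y : ΠB n} → Chain x y → Set where
  here  : ∀ {x z y} {c : x ⋖ z} {ch : Chain z y} → Label x z l → l ∈Labels step {x = x} c ch
  there : ∀ {x z y} {c : x ⋖ z} {ch : Chain z y} → l ∈Labels ch → l ∈Labels step {x = x} c ch

-- Call l a lowering of x in y when some non-zero block B of x with
-- min |B| = l lies in a block of y containing an element of absolute value
-- below l. For every chain of refinements from x to y the labels are exactly
-- the lowerings of x in y, which depend on x and y only. A label of a step
-- x ≼ z is a lowering, since the merged block with the larger minimum meets the
-- other block's minimum (or 0, when both minima are ±i). Conversely a lowering
-- of x in y is either already lowered in z, giving a label of x ≼ z, or
-- survives as a lowering of z in y.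
module Submission where

open import Defs
open import Data.Nat using (ℕ; zero; suc; _<_; _≤_; _≤?_; z≤n; s≤s)
open import Data.Nat.Properties
  using (≤-irrelevant; ≤-refl; ≤-<-trans; <⇒≤; <⇒≱; ≮⇒≥; <-cmp; m<n⇒m<1+n;
         m<1+n⇒m<n∨m≡n; ⊔-idem; m≤n⇒m⊔n≡n; m≥n⇒m⊔n≡m)
open import Data.Nat.Induction using (<-rec)
open import Data.Integer using (ℤ; +_; -_; ∣_∣; -[1+_])
open import Data.Integer.Properties using (∣i∣≡0⇒i≡0; neg-involutive; ∣-i∣≡∣i∣)
open import Data.Product using (∃; _×_; _,_; proj₁; proj₂)
open import Data.Sum using (_⊎_; inj₁; inj₂)
open import Data.Empty using (⊥-elim)
open import Function using (_∘_)
open import Function.Bundles using (_⇔_; mk⇔; Equivalence)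
open import Function.Properties.Equivalence using () renaming (sym to ⇔-sym; trans to ⇔-trans)
open import Relation.Binary using (tri<; tri≈; tri>)
open import Relation.Binary.PropositionalEquality using (_≡_; refl; sym; trans; cong; subst)
open import Relation.Nullary using (¬_; Dec; yes; no)
open import Relation.Nullary.Decidable using (T?)
open import Relation.Unary using (Pred; Decidable)

∣i∣≡∣j∣⇒i≡j⊎i≡-j : (i j : ℤ) → ∣ i ∣ ≡ ∣ j ∣ → i ≡ j ⊎ i ≡ - j
∣i∣≡∣j∣⇒i≡j⊎i≡-j (+ zero)  (+ zero)  _    = inj₁ refl
∣i∣≡∣j∣⇒i≡j⊎i≡-j (+ suc m) (+ suc m) refl = inj₁ refl
∣i∣≡∣j∣⇒i≡j⊎i≡-j (+ suc m) -[1+ m ]  refl = inj₂ refl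
∣i∣≡∣j∣⇒i≡j⊎i≡-j -[1+ m ]  (+ suc m) refl = inj₂ refl
∣i∣≡∣j∣⇒i≡j⊎i≡-j -[1+ m ]  -[1+ m ]  refl = inj₁ refl

module _ {ℓ} {P : Pred ℕ ℓ} (P? : Decidable P) where

  ∃<? : ∀ k → Dec (∃ λ j → j < k × P j)
  ∃<? zero = no λ ()
  ∃<? (suc k) with P? k | ∃<? k
  ... | yes pk | _                   = yes (k , ≤-refl , pk)
  ... | no _   | yes (j , j<k , pj)  = yes (j , m<n⇒m<1+n j<k , pj)
  ... | no ¬pk | no ¬∃               = no λ (j , j<1+k , pj) → case j<1+k pj
    where
    case : ∀ {j} → j < suc k → ¬ P j
    case j<1+k with m<1+n⇒m<n∨m≡n j<1+k
    ... | inj₁ j<k  = λ pj → ¬∃ (_ , j<k , pj)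
    ... | inj₂ refl = ¬pk

  least : ∀ {k} → P k → ∃ λ m → P m × (∀ j → P j → m ≤ j)
  least {k} = <-rec (λ k → P k → ∃ λ m → P m × (∀ j → P j → m ≤ j)) go k
    where
    go : ∀ k → (∀ {j} → j < k → P j → ∃ λ m → P m × (∀ j → P j → m ≤ j)) →
         P k → ∃ λ m → P m × (∀ j → P j → m ≤ j)
    go k rec pk with ∃<? k
    ... | yes (j , j<k , pj) = rec j<k pj
    ... | no ¬∃              = k , pk , λ j pj → ≮⇒≥ λ j<k → ¬∃ (j , j<k , pj)

module _ {n : ℕ} where

  proj₁-injective : (a b : Elem n) → proj₁ a ≡ proj₁ b → a ≡ b
  proj₁-injective (i , p) (i , q) refl = cong (i ,_) (≤-irrelevant p q)

  absₑ≡⇒≡⊎≡negₑ : (a b : Elem n) → absₑ a ≡ absₑ b → a ≡ b ⊎ a ≡ negₑ b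
  absₑ≡⇒≡⊎≡negₑ a b eq with ∣i∣≡∣j∣⇒i≡j⊎i≡-j (proj₁ a) (proj₁ b) eq
  ... | inj₁ a≡b  = inj₁ (proj₁-injective a b a≡b)
  ... | inj₂ a≡-b = inj₂ (proj₁-injective a (negₑ b) a≡-b)

  absₑ≡0⇒≡0ₑ : (a : Elem n) → absₑ a ≡ 0 → a ≡ 0ₑ
  absₑ≡0⇒≡0ₑ a eq = proj₁-injective a 0ₑ (∣i∣≡0⇒i≡0 eq)

  negₑ-involutive : (a : Elem n) → negₑ (negₑ a) ≡ a
  negₑ-involutive a = proj₁-injective _ a (neg-involutive (proj₁ a))

  absₑ-negₑ : (a : Elem n) → absₑ (negₑ a) ≡ absₑ a
  absₑ-negₑ a = ∣-i∣≡∣i∣ (proj₁ a)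

  infix 4 _∼[_]_
  _∼[_]_ : Elem n → ΠB n → Elem n → Set
  a ∼[ x ] b = _∼_ x a b

  ≁0ₑ-negₑ : (x : ΠB n) {a : Elem n} → ¬ a ∼[ x ] 0ₑ → ¬ negₑ a ∼[ x ] 0ₑ
  ≁0ₑ-negₑ x {a} a≁0 -a∼0 = a≁0 (subst (_∼[ x ] 0ₑ) (negₑ-involutive a) (∼-neg x -a∼0))

  ∼0ₑ⇒∼negₑ : (x : ΠB n) {a : Elem n} → a ∼[ x ] 0ₑ → a ∼[ x ] negₑ a
  ∼0ₑ⇒∼negₑ x a∼0 = ∼-trans x a∼0 (∼-sym x (∼-neg x a∼0))

  MinAbs-negₑ : (x : ΠB n) {a : Elem n} {m : ℕ} → MinAbs x a m → MinAbs x (negₑ a) m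
  MinAbs-negₑ x {a} {m} ((c , c∼a , ∣c∣≡m) , min) =
    (negₑ c , ∼-neg x c∼a , trans (absₑ-negₑ c) ∣c∣≡m) ,
    λ d d∼-a → subst (m ≤_) (absₑ-negₑ d)
                 (min (negₑ d) (subst (negₑ d ∼[ x ]_) (negₑ-involutive a) (∼-neg x d∼-a)))

  MinAbs-pos : (x : ΠB n) {a : Elem n} {m : ℕ} → ¬ a ∼[ x ] 0ₑ → MinAbs x a m → 0 < m
  MinAbs-pos x {m = zero} a≁0 ((c , c∼a , ∣c∣≡0) , _) with absₑ≡0⇒≡0ₑ c ∣c∣≡0
  ... | refl = ⊥-elim (a≁0 (∼-sym x c∼a))
  MinAbs-pos x {m = suc m} _ _ = s≤s z≤n

  HitsAbs : ΠB n → Elem n → ℕ → Set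
  HitsAbs x a k = ∃ λ c → absₑ c ≡ k × c ∼[ x ] a

  hitsAbs? : (x : ΠB n) (a : Elem n) → Decidable (HitsAbs x a)
  hitsAbs? x a k with k ≤? n
  ... | no k≰n = no λ (c , ∣c∣≡k , _) → k≰n (subst (_≤ n) ∣c∣≡k (proj₂ c))
  ... | yes k≤n with T? (blk x (+ k , k≤n) a) | T? (blk x (negₑ (+ k , k≤n)) a)
  ...   | yes k∼a | _      = yes (_ , refl , k∼a)
  ...   | no _    | yes -k∼a = yes (_ , absₑ-negₑ (+ k , k≤n) , -k∼a)
  ...   | no k≁a  | no -k≁a  = no λ (c , ∣c∣≡k , c∼a) → sign-case c ∣c∣≡k c∼a
    where
    sign-case : ∀ c → absₑ c ≡ k → ¬ c ∼[ x ] a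
    sign-case c ∣c∣≡k with absₑ≡⇒≡⊎≡negₑ c (+ k , k≤n) ∣c∣≡k
    ... | inj₁ refl = k≁a
    ... | inj₂ refl = -k≁a

  MinAbs-exists : (x : ΠB n) (a : Elem n) → ∃ (MinAbs x a)
  MinAbs-exists x a with least (hitsAbs? x a) (a , refl , ∼-refl x a)
  ... | m , (c , ∣c∣≡m , c∼a) , min =
    m , (c , c∼a , ∣c∣≡m) , λ d d∼a → min (absₑ d) (d , refl , d∼a)

  Chain⇒≼ : {x y : ΠB n} → Chain x y → x ≼ y
  Chain⇒≼ done                = λ _ _ a∼b → a∼b
  Chain⇒≼ (step x⋖z z⋯y) a b = Chain⇒≼ z⋯y a b ∘ proj₁ (proj₁ x⋖z) a b

  Lowered : ΠB n → ΠB n → ℕ → Set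
  Lowered x y l = ∃ λ a → ¬ a ∼[ x ] 0ₑ × MinAbs x a l × ∃ λ c → c ∼[ y ] a × absₑ c < l

  ¬Lowered-refl : (x : ΠB n) {l : ℕ} → ¬ Lowered x x l
  ¬Lowered-refl x (_ , _ , (_ , min) , c , c∼a , ∣c∣<l) = <⇒≱ ∣c∣<l (min c c∼a)

  module _ {x z : ΠB n} (x≼z : x ≼ z) where

    Lowered-merge : ∀ {y} → z ≼ y → ∀ {a b m m′} → ¬ a ∼[ x ] 0ₑ → MinAbs x a m →
                    a ∼[ z ] b → MinAbs x b m′ → m′ < m → Lowered x y m
    Lowered-merge z≼y {a} {b} a≁0 minA a∼b ((c , c∼b , refl) , _) m′<m =
      a , a≁0 , minA , c , z≼y c a (∼-trans z (x≼z c b c∼b) (∼-sym z a∼b)) , m′<m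

    -- Distinct blocks with the same minimum i must have minima ±i.
    merged-equal-minima⇒∼0ₑ : ∀ {a b m} → ¬ a ∼[ x ] b → a ∼[ z ] b →
                              MinAbs x a m → MinAbs x b m → b ∼[ z ] 0ₑ
    merged-equal-minima⇒∼0ₑ {a} {b} a≁b a∼b
                            ((c₁ , c₁∼a , ∣c₁∣≡m) , _) ((c₂ , c₂∼b , ∣c₂∣≡m) , _)
      with absₑ≡⇒≡⊎≡negₑ c₁ c₂ (trans ∣c₁∣≡m (sym ∣c₂∣≡m))
    ... | inj₁ refl = ⊥-elim (a≁b (∼-trans x (∼-sym x c₁∼a) c₂∼b))
    ... | inj₂ refl = ∼-trans z (∼-sym z (x≼z c₂ b c₂∼b)) (∼-zero z c₂∼-c₂)
      where
      c₂∼-c₂ : c₂ ∼[ z ] negₑ c₂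
      c₂∼-c₂ = ∼-trans z (x≼z c₂ b c₂∼b) (∼-trans z (∼-sym z a∼b) (x≼z a _ (∼-sym x c₁∼a)))

    Label⇒Lowered : ∀ {y} → z ≼ y → ∀ {l} → Label x z l → Lowered x y l
    Label⇒Lowered {y} z≼y (a , b , m₁ , m₂ , a≁0 , b≁0 , a≁b , a∼b , minA , minB , refl)
      with <-cmp m₁ m₂
    ... | tri< m₁<m₂ _ _ = subst (Lowered x y) (sym (m≤n⇒m⊔n≡n (<⇒≤ m₁<m₂)))
                             (Lowered-merge {y} z≼y b≁0 minB (∼-sym z a∼b) minA m₁<m₂)
    ... | tri> _ _ m₂<m₁ = subst (Lowered x y) (sym (m≥n⇒m⊔n≡m (<⇒≤ m₂<m₁)))
                             (Lowered-merge {y} z≼y a≁0 minA a∼b minB m₂<m₁)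
    ... | tri≈ _ refl _  = subst (Lowered x y) (sym (⊔-idem m₁))
                             (b , b≁0 , minB , 0ₑ , ∼-sym y b∼0 , MinAbs-pos x b≁0 minB)
      where
      b∼0 : b ∼[ y ] 0ₑ
      b∼0 = z≼y b 0ₑ (merged-equal-minima⇒∼0ₑ a≁b a∼b minA minB)

    Lowered-pullback : ∀ {y} → z ≼ y → ∀ {l} → Lowered z y l → Lowered x y l
    Lowered-pullback {y} z≼y (a , a≁0 , ((d , d∼a , ∣d∣≡l) , min) , c , c∼a , ∣c∣<l) =
      d , (λ d∼0 → a≁0 (∼-trans z (∼-sym z d∼a) (x≼z d 0ₑ d∼0))) ,
      ((d , ∼-refl x d , ∣d∣≡l) , λ e e∼d → min e (∼-trans z (x≼z e d e∼d) d∼a)) ,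
      c , ∼-trans y c∼a (∼-sym y (z≼y d a d∼a)) , ∣c∣<l

    Lowered-split : ∀ {y l} → Lowered x y l → Label x z l ⊎ Lowered z y l
    Lowered-split {l = l} (a , a≁0 , minA@((c , c∼a , ∣c∣≡l) , min) , lowering)
      with ∃<? (hitsAbs? z a) l
    ... | no ¬∃ = inj₂ (a , a≁0ᶻ , minAᶻ , lowering)
      where
      a≁0ᶻ : ¬ a ∼[ z ] 0ₑ
      a≁0ᶻ a∼0 = ¬∃ (0 , MinAbs-pos x a≁0 minA , 0ₑ , refl , ∼-sym z a∼0)
      minAᶻ : MinAbs z a l
      minAᶻ = (c , x≼z c a c∼a , ∣c∣≡l) ,
              λ d d∼a → ≮⇒≥ λ ∣d∣<l → ¬∃ (absₑ d , ∣d∣<l , d , refl , d∼a)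
    ... | yes (_ , ∣d∣<l , d , refl , d∼a) with T? (blk x d 0ₑ)
    ...   | yes d∼0 = inj₁ (a , negₑ a , l , l , a≁0 , ≁0ₑ-negₑ x a≁0 , a≁0 ∘ ∼-zero x ,
                            ∼0ₑ⇒∼negₑ z (∼-trans z (∼-sym z d∼a) (x≼z d 0ₑ d∼0)) ,
                            minA , MinAbs-negₑ x minA , sym (⊔-idem l))
    ...   | no d≁0 with MinAbs-exists x d
    ...     | m , minD@(_ , minD≤) =
                inj₁ (a , d , l , m , a≁0 , d≁0 , a≁d , ∼-sym z d∼a , minA , minD ,
                      sym (m≥n⇒m⊔n≡m (<⇒≤ (≤-<-trans (minD≤ d (∼-refl x d)) ∣d∣<l))))
      where
      a≁d : ¬ a ∼[ x ] d
      a≁d a∼d = <⇒≱ ∣d∣<l (min d (∼-sym x a∼d))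

  Labels⇔Lowered : {x y : ΠB n} (ch : Chain x y) (l : ℕ) → l ∈Labels ch ⇔ Lowered x y l
  Labels⇔Lowered {x} done l = mk⇔ (λ ()) (⊥-elim ∘ ¬Lowered-refl x)
  Labels⇔Lowered {x} {y} (step {z = z} x⋖z z⋯y) l = mk⇔ to from
    where
    x≼z : x ≼ z
    x≼z = proj₁ (proj₁ x⋖z)
    IH : l ∈Labels z⋯y ⇔ Lowered z y l
    IH = Labels⇔Lowered z⋯y l

    to : l ∈Labels step x⋖z z⋯y → Lowered x y l
    to (here lab) = Label⇒Lowered {x} {z} x≼z {y} (Chain⇒≼ z⋯y) lab
    to (there l∈) = Lowered-pullback {x} {z} x≼z {y} (Chain⇒≼ z⋯y) (Equivalence.to IH l∈)

    from : Lowered x y l → l ∈Labels step x⋖z z⋯y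
    from low with Lowered-split {x} {z} x≼z {y} low
    ... | inj₁ lab  = here lab
    ... | inj₂ low′ = there (Equivalence.from IH low′)

lemma4p7 : (n : ℕ) (x y : ΠB n) → x ≺ y → (c₁ c₂ : Chain x y) →
    (l : ℕ) → (l ∈Labels c₁) ⇔ (l ∈Labels c₂)
lemma4p7 n x y _ c₁ c₂ l = ⇔-trans (Labels⇔Lowered c₁ l) (⇔-sym (Labels⇔Lowered c₂ l))
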